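{- Any streaming algorithm for \textsc{Connectivity} in the AL model that works on a family of graphs including all graphs of maximum degree $2$ and uses $p$ passes over the stream requires $\Omega(n/p)$ bits of memory on $n$-vertex graphs.
   Context: \textsc{Connectivity}: decide whether the graph is connected. In the Adjacency List (AL) streaming model the graph arrives as a sequence of vertices in arbitrary fixed order, each with the full list of its incident edges (each edge appears twice). A $p$-pass algorithm reads the sequence $p$ times with unlimited computation; memory is in bits. "Requires $\Omega(f)$ bits" means there is a constant $c>0$ such that every such algorithm uses at least $cf$ bits on some $n$-vertex input of the class, for all sufficiently large $n$ and all $p$. -}

module Defs where

open import Data.Nat using (ℕ; _≤_)
open import Data.Bool using (Bool; true; false)
open import Data.Fin using (Fin)
open import Data.List using (List; foldl; filterᵇ; length; map; allFin)
open import Data.Product using (_×_; proj₁)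
open import Relation.Binary.PropositionalEquality using (_≡_)
open import Data.List.Relation.Binary.Permutation.Propositional using (_↭_)

record Graph (n : ℕ) : Set where
  field
    adj   : Fin n → Fin n → Bool
    sym   : ∀ u v → adj u v ≡ adj v u
    irref : ∀ v → adj v v ≡ false
open Graph public

neighbours : ∀ {n} → Graph n → Fin n → List (Fin n)
neighbours {n} G v = filterᵇ (adj G v) (allFin n)

degree : ∀ {n} → Graph n → Fin n → ℕ
degree G v = length (neighbours G v)

MaxDegree≤2 : ∀ {n} → Graph n → Set
MaxDegree≤2 G = ∀ v → degree G v ≤ 2

data Reachable {n : ℕ} (G : Graph n) : Fin n → Fin n → Set where
  here : ∀ {v} → Reachable G v v
  step : ∀ {u v w} → adj G u v ≡ true → Reachable G v w → Reachable G u w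

Connected : ∀ {n} → Graph n → Set
Connected G = ∀ u v → Reachable G u v

-- AL model: a stream item is a vertex together with the list of its neighbours.
Item : ℕ → Set
Item n = Fin n × List (Fin n)

data ValidItems {n : ℕ} (G : Graph n) : List (Item n) → Set where
  []  : ValidItems G Data.List.[]
  _∷_ : ∀ {v L xs} → L ↭ neighbours G v → ValidItems G xs →
        ValidItems G (Data.List._∷_ (v Data.Product., L) xs)

ValidStream : ∀ {n} → Graph n → List (Item n) → Set
ValidStream {n} G str = ValidItems G str × (map proj₁ str ↭ allFin n)

-- A deterministic p-pass streaming algorithm with s bits of memory on
-- n-vertex inputs: its memory state is one of 2^s values. Computation between
-- items is unrestricted (arbitrary transition function, which may also depend
-- on the index of the current pass).
record StreamAlg (n p s : ℕ) : Set where
  field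
    init  : Fin (2 Data.Nat.^ s)
    trans : Fin p → Fin (2 Data.Nat.^ s) → Item n → Fin (2 Data.Nat.^ s)
    out   : Fin (2 Data.Nat.^ s) → Bool
open StreamAlg public

runPass : ∀ {n p s} → StreamAlg n p s → Fin p → Fin (2 Data.Nat.^ s) →
          List (Item n) → Fin (2 Data.Nat.^ s)
runPass A i st str = foldl (λ m x → trans A i m x) st str

run : ∀ {n p s} → StreamAlg n p s → List (Item n) → Bool
run {p = p} A str =
  out A (foldl (λ m i → runPass A i m str) (init A) (allFin p))

SolvesConnMaxDeg2 : ∀ {n p s} → StreamAlg n p s → Set
SolvesConnMaxDeg2 {n} A =
  ∀ (G : Graph n) → MaxDegree≤2 G → ∀ str → ValidStream G str →
    (run A str ≡ true → Connected G) × (Connected G → run A str ≡ true)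

-- A p-pass algorithm with s bits of memory, run on a stream cut into a prefix u and a suffix v, passes
-- only 2p states of s bits across the cut. For x, y ∈ {0,1}^m let G(x, y) be the graph on n ≥ 8m
-- vertices whose edges are {k, twist x y (k + 1)}, where the involution twist x y swaps 8i+1 ↔ 8i+5
-- when x_i = 1 and 8i+3 ↔ 8i+7 when y_i = 1. The edges at the vertices 0, 1, 4, 5 (mod 8) depend on x
-- only, those at 2, 3, 6, 7 on y only, so listing the first kind of vertices first gives a stream
-- u(x) ++ v(y) of G(x, y). Every G(x, y) has maximum degree 2; G(x, x) is a relabelled path, while
-- G(x, y) has a 4-cycle as a component in a block where x and y differ. If 2sp < m, two inputs x ≠ y
-- send the same states across the cut, so the algorithm answers on u(x) ++ v(y) as on u(x) ++ v(x),
-- which is wrong. Hence n / 8 ≤ 2sp.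

module Submission where

open import Defs hiding (sym; trans)
open import Data.Bool using (Bool; true; false; not; _∨_; T; T?; if_then_else_)
open import Data.Bool.Properties using (∨-comm; T-≡; T-∨; ¬-not)
open import Data.Empty using (⊥; ⊥-elim)
open import Data.Fin using (Fin; zero; toℕ; fromℕ<; combine; quotient; remainder)
open import Data.Fin.Properties
  using (toℕ-injective; toℕ-fromℕ<; toℕ<n; 2↔Bool; combine-remQuot; combine-injective; pigeonhole; <⇒≢)
open import Data.List using (List; []; _∷_; _++_; length; map; filter; allFin; foldl)
open import Data.List.Properties
  using (length-map; length-tabulate; filter-≐; map-∘; map-id; map-++; foldl-++; partition-defn)
open import Data.List.Relation.Binary.Permutation.Propositional using (_↭_; ↭-sym; ↭-reflexive; ↭ₛ⇒↭)
open import Data.List.Relation.Binary.Permutation.Setoid.Properties using (partition-↭)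
open import Data.List.Relation.Unary.All as All using (All; []; _∷_)
open import Data.List.Relation.Unary.All.Properties using (all-filter) renaming (map⁺ to All-map⁺)
open import Data.List.Relation.Unary.AllPairs using ([]; _∷_)
open import Data.List.Relation.Unary.Unique.Propositional using (Unique)
import Data.List.Relation.Unary.Unique.Propositional.Properties as Unique
open import Data.Nat using (ℕ; zero; suc; pred; _+_; _*_; _^_; _≤_; _<_; s≤s; z≤n; _≟_)
open import Data.Nat.Properties
  using (≡ᵇ⇒≡; <ᵇ⇒<; 1+n≢n; +-cancelˡ-≡; n≤1+n; m≤n⇒m≤n+o; ≤-trans; <-≤-trans; ≤-<-trans; <⇒≤; ≮⇒≥;
         ≤-reflexive; +-monoʳ-<; +-mono-≤; *-monoʳ-≤; *-monoˡ-≤; ^-monoʳ-<; ^-distribˡ-+-*; ^-*-assoc;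
         module ≤-Reasoning)
open import Data.Nat.DivMod using (_/_; _%_; m≡m%n+[m/n]*n; m%n<n; m/n*n≤m; m≥n⇒m/n>0)
open import Data.Nat.Solver using (module +-*-Solver)
open +-*-Solver using (solve; _:+_; _:*_; _:=_; con)
open import Data.Product as Product using (_×_; _,_; proj₁; proj₂; ∃-syntax; ∃₂)
open import Data.Product.Properties using (,-injective)
open import Data.Sum as Sum using (_⊎_; inj₁; inj₂)
open import Data.Vec using (Vec; []; _∷_)
open import Data.Vec.Properties using (∷-injectiveˡ; ∷-injectiveʳ)
open import Function using (id; _∘_; _⇔_; mk⇔; Equivalence; Inverse)
open import Relation.Binary.PropositionalEquality
open import Relation.Nullary using (¬_; does)
open import Relation.Nullary.Decidable using (dec-true; dec-false; does-⇔)
open import Relation.Unary using () renaming (Decidable to Decidable₁)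
open import Relation.Unary.Properties using (∁?)
open import Algebra.Definitions {A = ℕ} _≡_ using (Involutive)

true≢false : true ≢ false
true≢false ()

module _ {n} {G : Graph n} where

  reachable-trans : ∀ {u v w} → Reachable G u v → Reachable G v w → Reachable G u w
  reachable-trans here       r = r
  reachable-trans (step e q) r = step e (reachable-trans q r)

  reachable-sym : ∀ {u v} → Reachable G u v → Reachable G v u
  reachable-sym here       = here
  reachable-sym (step e r) = reachable-trans (reachable-sym r) (step (trans (Graph.sym G _ _) e) here)

  reachable-invariant : (P : Fin n → Bool) → (∀ {u v} → adj G u v ≡ true → P u ≡ P v) →
                        ∀ {u v} → Reachable G u v → P u ≡ P v
  reachable-invariant P P-adj here       = refl
  reachable-invariant P P-adj (step e r) = trans (P-adj e) (reachable-invariant P P-adj r)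

  invariant⇒¬connected : (P : Fin n → Bool) → (∀ {u v} → adj G u v ≡ true → P u ≡ P v) →
                         ∀ {u v} → P u ≡ true → P v ≡ false → ¬ Connected G
  invariant⇒¬connected P P-adj {u} {v} Pu Pv connected =
    true≢false (trans (sym Pu) (trans (reachable-invariant P P-adj (connected u v)) Pv))

  hamiltonian-path⇒connected : (π : ℕ → ℕ) → (∀ {t} → t < n → π t < n) →
                               (∀ {t u v} → toℕ u ≡ π t → toℕ v ≡ π (suc t) → adj G u v ≡ true) →
                               (∀ v → ∃[ t ] t < n × toℕ v ≡ π t) →
                               Connected G
  hamiltonian-path⇒connected π π-< π-adj π-onto u v with π-onto u | π-onto v
  ... | i , i<n , u≡πi | j , j<n , v≡πj =
    reachable-trans (to-start i<n u≡πi) (reachable-sym (to-start j<n v≡πj))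
    where
    start : Fin n
    start = fromℕ< (π-< (≤-trans (s≤s z≤n) i<n))
    to-start : ∀ {t} → t < n → ∀ {w} → toℕ w ≡ π t → Reachable G w start
    to-start {zero} _ {w} w≡π0 =
      subst (λ x → Reachable G w x) (toℕ-injective (trans w≡π0 (sym (toℕ-fromℕ< _)))) here
    to-start {suc t} st<n {w} w≡πst =
      step (trans (Graph.sym G w prev) (π-adj (toℕ-fromℕ< _) w≡πst)) (to-start t<n (toℕ-fromℕ< _))
      where
      t<n : t < n
      t<n = ≤-trans (n≤1+n (suc t)) st<n
      prev : Fin n
      prev = fromℕ< (π-< t<n)

neighbours-cong : ∀ {n} (G H : Graph n) v → (∀ w → adj G v w ≡ adj H v w) →
                  neighbours G v ≡ neighbours H v
neighbours-cong {n} G H v e =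
  filter-≐ (T? ∘ adj G v) (T? ∘ adj H v)
           ((λ {w} → subst T (e w)) , (λ {w} → subst T (sym (e w)))) (allFin n)

no-three-in-pair : ∀ {A : Set} {c d a b e : A} →
                   a ≡ c ⊎ a ≡ d → b ≡ c ⊎ b ≡ d → e ≡ c ⊎ e ≡ d →
                   a ≢ b → a ≢ e → b ≢ e → ⊥
no-three-in-pair (inj₁ refl) (inj₁ refl) _           a≢b _   _   = a≢b refl
no-three-in-pair (inj₂ refl) (inj₂ refl) _           a≢b _   _   = a≢b refl
no-three-in-pair (inj₁ refl) (inj₂ refl) (inj₁ refl) _   a≢e _   = a≢e refl
no-three-in-pair (inj₁ refl) (inj₂ refl) (inj₂ refl) _   _   b≢e = b≢e refl
no-three-in-pair (inj₂ refl) (inj₁ refl) (inj₁ refl) _   _   b≢e = b≢e refl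
no-three-in-pair (inj₂ refl) (inj₁ refl) (inj₂ refl) _   a≢e _   = a≢e refl

unique-pair-length : ∀ {A : Set} {c d : A} {xs : List A} →
                     Unique xs → All (λ a → a ≡ c ⊎ a ≡ d) xs → length xs ≤ 2
unique-pair-length _ [] = z≤n
unique-pair-length _ (_ ∷ []) = s≤s z≤n
unique-pair-length _ (_ ∷ _ ∷ []) = s≤s (s≤s z≤n)
unique-pair-length ((a≢b ∷ a≢e ∷ _) ∷ (b≢e ∷ _) ∷ _) (a∈ ∷ b∈ ∷ e∈ ∷ _) =
  ⊥-elim (no-three-in-pair a∈ b∈ e∈ a≢b a≢e b≢e)

involutive-swap : ∀ τ → Involutive τ → ∀ {u v} → τ u ≡ v → τ v ≡ u
involutive-swap τ τ-inv {u} refl = τ-inv u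

link : (ℕ → ℕ) → ℕ → ℕ → Bool
link τ a b = does (τ (suc a) ≟ b) ∨ does (τ (suc b) ≟ a)

link-irrefl : ∀ τ → (∀ k → τ (suc k) ≢ k) → ∀ a → link τ a a ≡ false
link-irrefl τ τ-suc≢ a rewrite dec-false (_ ≟ a) (τ-suc≢ a) = refl

link⇒ : ∀ τ a b → link τ a b ≡ true → τ (suc a) ≡ b ⊎ τ (suc b) ≡ a
link⇒ τ a b e =
  Sum.map (≡ᵇ⇒≡ _ _) (≡ᵇ⇒≡ _ _) (Equivalence.to T-∨ (Equivalence.from T-≡ e))

⇒link : ∀ τ {a b} → τ (suc a) ≡ b → link τ a b ≡ true
⇒link τ {a} {b} p rewrite dec-true (τ (suc a) ≟ b) p = refl

link-local : ∀ τ τ′ → Involutive τ → Involutive τ′ → ∀ {a} →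
             τ a ≡ τ′ a → τ (suc a) ≡ τ′ (suc a) → ∀ b → link τ a b ≡ link τ′ a b
link-local τ τ′ τ-inv τ′-inv {a} τa≡τ′a τsa≡τ′sa b =
  cong₂ _∨_ (cong (λ c → does (c ≟ b)) τsa≡τ′sa) (does-⇔ predecessor (τ (suc b) ≟ a) (τ′ (suc b) ≟ a))
  where
  predecessor : τ (suc b) ≡ a ⇔ τ′ (suc b) ≡ a
  predecessor = mk⇔
    (λ p → involutive-swap τ′ τ′-inv (trans (sym τa≡τ′a) (involutive-swap τ τ-inv p)))
    (λ p → involutive-swap τ τ-inv (trans τa≡τ′a (involutive-swap τ′ τ′-inv p)))

linkGraph : ∀ {n} (τ : ℕ → ℕ) → (∀ k → τ (suc k) ≢ k) → Graph n
linkGraph τ τ-suc≢ = record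
  { adj   = λ u v → link τ (toℕ u) (toℕ v)
  ; sym   = λ u v → ∨-comm (does (τ (suc (toℕ u)) ≟ toℕ v)) _
  ; irref = λ v → link-irrefl τ τ-suc≢ (toℕ v)
  }

linkGraph-maxDegree≤2 : ∀ {n} τ (τ-suc≢ : ∀ k → τ (suc k) ≢ k) → Involutive τ →
                        MaxDegree≤2 (linkGraph {n} τ τ-suc≢)
linkGraph-maxDegree≤2 {n} τ τ-suc≢ τ-inv v =
  subst (_≤ 2) (length-map toℕ (neighbours G v)) (unique-pair-length unique positions)
  where
  G : Graph n
  G = linkGraph τ τ-suc≢
  adjacent? : Decidable₁ (T ∘ adj G v)
  adjacent? = T? ∘ adj G v
  unique : Unique (map toℕ (neighbours G v))
  unique = Unique.map⁺ toℕ-injective (Unique.filter⁺ adjacent? (Unique.allFin⁺ n))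
  position : ∀ {w} → T (adj G v w) → toℕ w ≡ τ (suc (toℕ v)) ⊎ toℕ w ≡ pred (τ (toℕ v))
  position {w} t with link⇒ τ (toℕ v) (toℕ w) (Equivalence.to T-≡ t)
  ... | inj₁ p = inj₁ (sym p)
  ... | inj₂ q = inj₂ (cong pred (sym (involutive-swap τ τ-inv q)))
  positions : All (λ k → k ≡ τ (suc (toℕ v)) ⊎ k ≡ pred (τ (toℕ v))) (map toℕ (neighbours G v))
  positions = All-map⁺ (All.map position (all-filter adjacent? (allFin n)))

pattern 8+_ k = suc (suc (suc (suc (suc (suc (suc (suc k)))))))

twist : ∀ {m} → Vec Bool m → Vec Bool m → ℕ → ℕ
twist []       []       k      = k
twist (x ∷ _)  (_ ∷ _)  1      = if x then 5 else 1
twist (_ ∷ _)  (y ∷ _)  3      = if y then 7 else 3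
twist (x ∷ _)  (_ ∷ _)  5      = if x then 1 else 5
twist (_ ∷ _)  (y ∷ _)  7      = if y then 3 else 7
twist (_ ∷ xs) (_ ∷ ys) (8+ k) = 8 + twist xs ys k
twist (_ ∷ _)  (_ ∷ _)  k      = k

twist-zero : ∀ {m} (x y : Vec Bool m) → twist x y 0 ≡ 0
twist-zero []      []      = refl
twist-zero (_ ∷ _) (_ ∷ _) = refl

twist-involutive : ∀ {m} (x y : Vec Bool m) → Involutive (twist x y)
twist-involutive []           []           k      = refl
twist-involutive (_     ∷ _)  (_     ∷ _)  0      = refl
twist-involutive (true  ∷ _)  (_     ∷ _)  1      = refl
twist-involutive (false ∷ _)  (_     ∷ _)  1      = refl
twist-involutive (_     ∷ _)  (_     ∷ _)  2      = refl
twist-involutive (_     ∷ _)  (true  ∷ _)  3      = refl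
twist-involutive (_     ∷ _)  (false ∷ _)  3      = refl
twist-involutive (_     ∷ _)  (_     ∷ _)  4      = refl
twist-involutive (true  ∷ _)  (_     ∷ _)  5      = refl
twist-involutive (false ∷ _)  (_     ∷ _)  5      = refl
twist-involutive (_     ∷ _)  (_     ∷ _)  6      = refl
twist-involutive (_     ∷ _)  (true  ∷ _)  7      = refl
twist-involutive (_     ∷ _)  (false ∷ _)  7      = refl
twist-involutive (_     ∷ xs) (_     ∷ ys) (8+ k) = cong (8 +_) (twist-involutive xs ys k)

twist-suc≢ : ∀ {m} (x y : Vec Bool m) k → twist x y (suc k) ≢ k
twist-suc≢ []           []           k      = 1+n≢n
twist-suc≢ (true  ∷ _)  (_     ∷ _)  0      = λ ()
twist-suc≢ (false ∷ _)  (_     ∷ _)  0      = λ ()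
twist-suc≢ (_     ∷ _)  (_     ∷ _)  1      = λ ()
twist-suc≢ (_     ∷ _)  (true  ∷ _)  2      = λ ()
twist-suc≢ (_     ∷ _)  (false ∷ _)  2      = λ ()
twist-suc≢ (_     ∷ _)  (_     ∷ _)  3      = λ ()
twist-suc≢ (true  ∷ _)  (_     ∷ _)  4      = λ ()
twist-suc≢ (false ∷ _)  (_     ∷ _)  4      = λ ()
twist-suc≢ (_     ∷ _)  (_     ∷ _)  5      = λ ()
twist-suc≢ (_     ∷ _)  (true  ∷ _)  6      = λ ()
twist-suc≢ (_     ∷ _)  (false ∷ _)  6      = λ ()
twist-suc≢ (_     ∷ _)  (_     ∷ _)  7      = λ ()
twist-suc≢ (_     ∷ xs) (_     ∷ ys) (8+ k) = twist-suc≢ xs ys k ∘ +-cancelˡ-≡ 8 _ _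

straighten : ∀ {m} → Vec Bool m → ℕ → ℕ
straighten []       k      = k
straighten (x ∷ _)  1      = if x then 5 else 1
straighten (x ∷ _)  2      = if x then 6 else 2
straighten (x ∷ _)  5      = if x then 1 else 5
straighten (x ∷ _)  6      = if x then 2 else 6
straighten (_ ∷ xs) (8+ k) = 8 + straighten xs k
straighten (_ ∷ _)  k      = k

straighten-zero : ∀ {m} (x : Vec Bool m) → straighten x 0 ≡ 0
straighten-zero []      = refl
straighten-zero (_ ∷ _) = refl

straighten-involutive : ∀ {m} (x : Vec Bool m) → Involutive (straighten x)
straighten-involutive []          k      = refl
straighten-involutive (_     ∷ _) 0      = refl
straighten-involutive (true  ∷ _) 1      = refl
straighten-involutive (false ∷ _) 1      = refl
straighten-involutive (true  ∷ _) 2      = refl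
straighten-involutive (false ∷ _) 2      = refl
straighten-involutive (_     ∷ _) 3      = refl
straighten-involutive (_     ∷ _) 4      = refl
straighten-involutive (true  ∷ _) 5      = refl
straighten-involutive (false ∷ _) 5      = refl
straighten-involutive (true  ∷ _) 6      = refl
straighten-involutive (false ∷ _) 6      = refl
straighten-involutive (_     ∷ _) 7      = refl
straighten-involutive (_     ∷ x) (8+ k) = cong (8 +_) (straighten-involutive x k)

-- So G(x, x) is the path 0 — 1 — 2 — ⋯ relabelled by the involution straighten x.
twist-straighten : ∀ {m} (x : Vec Bool m) k → twist x x (suc (straighten x k)) ≡ straighten x (suc k)
twist-straighten []          k      = refl
twist-straighten (_     ∷ _) 0      = refl
twist-straighten (true  ∷ _) 1      = refl
twist-straighten (false ∷ _) 1      = refl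
twist-straighten (true  ∷ _) 2      = refl
twist-straighten (false ∷ _) 2      = refl
twist-straighten (_     ∷ _) 3      = refl
twist-straighten (true  ∷ _) 4      = refl
twist-straighten (false ∷ _) 4      = refl
twist-straighten (true  ∷ _) 5      = refl
twist-straighten (false ∷ _) 5      = refl
twist-straighten (true  ∷ _) 6      = refl
twist-straighten (false ∷ _) 6      = refl
twist-straighten (_     ∷ x) 7      = cong (8 +_) (trans (twist-zero x x) (sym (straighten-zero x)))
twist-straighten (_     ∷ x) (8+ k) = cong (8 +_) (twist-straighten x k)

straighten-bound : ∀ {m} (x : Vec Bool m) k → straighten x k ≡ k ⊎ straighten x k < m * 8
straighten-bound []          k      = inj₁ refl
straighten-bound (_     ∷ _) 0      = inj₁ refl
straighten-bound (true  ∷ _) 1      = inj₂ (m≤n⇒m≤n+o _ (<ᵇ⇒< 5 8 _))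
straighten-bound (false ∷ _) 1      = inj₁ refl
straighten-bound (true  ∷ _) 2      = inj₂ (m≤n⇒m≤n+o _ (<ᵇ⇒< 6 8 _))
straighten-bound (false ∷ _) 2      = inj₁ refl
straighten-bound (_     ∷ _) 3      = inj₁ refl
straighten-bound (_     ∷ _) 4      = inj₁ refl
straighten-bound (true  ∷ _) 5      = inj₂ (m≤n⇒m≤n+o _ (<ᵇ⇒< 1 8 _))
straighten-bound (false ∷ _) 5      = inj₁ refl
straighten-bound (true  ∷ _) 6      = inj₂ (m≤n⇒m≤n+o _ (<ᵇ⇒< 2 8 _))
straighten-bound (false ∷ _) 6      = inj₁ refl
straighten-bound (_     ∷ _) 7      = inj₁ refl
straighten-bound (_     ∷ x) (8+ k) = Sum.map (cong (8 +_)) (+-monoʳ-< 8) (straighten-bound x k)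

xSide : ℕ → Bool
xSide 0      = true
xSide 1      = true
xSide 2      = false
xSide 3      = false
xSide 4      = true
xSide 5      = true
xSide 6      = false
xSide 7      = false
xSide (8+ k) = xSide k

twist-xSide : ∀ {m} (x y y′ : Vec Bool m) k → xSide k ≡ true →
              twist x y k ≡ twist x y′ k × twist x y (suc k) ≡ twist x y′ (suc k)
twist-xSide []       []       []        k      _ = refl , refl
twist-xSide (_ ∷ _)  (_ ∷ _)  (_ ∷ _)   0      _ = refl , refl
twist-xSide (_ ∷ _)  (_ ∷ _)  (_ ∷ _)   1      _ = refl , refl
twist-xSide (_ ∷ _)  (_ ∷ _)  (_ ∷ _)   4      _ = refl , refl
twist-xSide (_ ∷ _)  (_ ∷ _)  (_ ∷ _)   5      _ = refl , refl
twist-xSide (_ ∷ xs) (_ ∷ ys) (_ ∷ ys′) (8+ k) s =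
  Product.map (cong (8 +_)) (cong (8 +_)) (twist-xSide xs ys ys′ k s)

twist-ySide : ∀ {m} (x x′ y : Vec Bool m) k → xSide k ≡ false →
              twist x y k ≡ twist x′ y k × twist x y (suc k) ≡ twist x′ y (suc k)
twist-ySide []       []        []       k      _ = refl , refl
twist-ySide (_ ∷ _)  (_ ∷ _)   (_ ∷ _)  2      _ = refl , refl
twist-ySide (_ ∷ _)  (_ ∷ _)   (_ ∷ _)  3      _ = refl , refl
twist-ySide (_ ∷ _)  (_ ∷ _)   (_ ∷ _)  6      _ = refl , refl
twist-ySide (_ ∷ xs) (_ ∷ xs′) (_ ∷ ys) 7      _ =
  refl , cong (8 +_) (trans (twist-zero xs ys) (sym (twist-zero xs′ ys)))
twist-ySide (_ ∷ xs) (_ ∷ xs′) (_ ∷ ys) (8+ k) s =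
  Product.map (cong (8 +_)) (cong (8 +_)) (twist-ySide xs xs′ ys k s)

data Differ : ∀ {m} → Vec Bool m → Vec Bool m → Set where
  here  : ∀ {m b} {xs ys : Vec Bool m} → Differ (b ∷ xs) (not b ∷ ys)
  there : ∀ {m b c} {xs ys : Vec Bool m} → Differ xs ys → Differ (b ∷ xs) (c ∷ ys)

≢⇒Differ : ∀ {m} {x y : Vec Bool m} → x ≢ y → Differ x y
≢⇒Differ {x = []}        {[]}        x≢y = ⊥-elim (x≢y refl)
≢⇒Differ {x = true ∷ _}  {false ∷ _} _   = here
≢⇒Differ {x = false ∷ _} {true ∷ _}  _   = here
≢⇒Differ {x = true ∷ _}  {true ∷ _}  x≢y = there (≢⇒Differ (x≢y ∘ cong (true ∷_)))
≢⇒Differ {x = false ∷ _} {false ∷ _} x≢y = there (≢⇒Differ (x≢y ∘ cong (false ∷_)))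

-- In a block with bits (b, not b), the vertices 1, 2, 3, 4 (if b) or 3, 4, 5, 6 (if not b)
-- form a 4-cycle.
cycleAt : Bool → ℕ → Bool
cycleAt b 1 = b
cycleAt b 2 = b
cycleAt b 3 = true
cycleAt b 4 = true
cycleAt b 5 = not b
cycleAt b 6 = not b
cycleAt b _ = false

cycle : ∀ {m} {x y : Vec Bool m} → Differ x y → ℕ → Bool
cycle (here {b = b}) k      = cycleAt b k
cycle (there d)      (8+ k) = cycle d k
cycle (there _)      _      = false

cycle-zero : ∀ {m} {x y : Vec Bool m} (d : Differ x y) → cycle d 0 ≡ false
cycle-zero here      = refl
cycle-zero (there _) = refl

cycle-invariant : ∀ {m} {x y : Vec Bool m} (d : Differ x y) k → cycle d (twist x y (suc k)) ≡ cycle d k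
cycle-invariant (here {b = true})              0      = refl
cycle-invariant (here {b = false})             0      = refl
cycle-invariant here                           1      = refl
cycle-invariant (here {b = true})              2      = refl
cycle-invariant (here {b = false})             2      = refl
cycle-invariant here                           3      = refl
cycle-invariant (here {b = true})              4      = refl
cycle-invariant (here {b = false})             4      = refl
cycle-invariant here                           5      = refl
cycle-invariant (here {b = true})              6      = refl
cycle-invariant (here {b = false})             6      = refl
cycle-invariant here                           7      = refl
cycle-invariant here                           (8+ k) = refl
cycle-invariant (there {b = true}  _)          0      = refl
cycle-invariant (there {b = false} _)          0      = refl
cycle-invariant (there _)                      1      = refl
cycle-invariant (there {c = true}  _)          2      = refl
cycle-invariant (there {c = false} _)          2      = refl
cycle-invariant (there _)                      3      = refl
cycle-invariant (there {b = true}  _)          4      = refl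
cycle-invariant (there {b = false} _)          4      = refl
cycle-invariant (there _)                      5      = refl
cycle-invariant (there {c = true}  _)          6      = refl
cycle-invariant (there {c = false} _)          6      = refl
cycle-invariant (there {xs = xs} {ys} d)       7      =
  trans (cong (cycle d) (twist-zero xs ys)) (cycle-zero d)
cycle-invariant (there d)                      (8+ k) = cycle-invariant d k

cycle-witness : ∀ {m} {x y : Vec Bool m} → Differ x y → ℕ
cycle-witness here      = 3
cycle-witness (there d) = 8 + cycle-witness d

cycle-witness-on : ∀ {m} {x y : Vec Bool m} (d : Differ x y) → cycle d (cycle-witness d) ≡ true
cycle-witness-on here      = refl
cycle-witness-on (there d) = cycle-witness-on d

cycle-witness-< : ∀ {m} {x y : Vec Bool m} (d : Differ x y) → cycle-witness d < m * 8
cycle-witness-< here      = m≤n⇒m≤n+o _ (<ᵇ⇒< 3 8 _)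
cycle-witness-< (there d) = +-monoʳ-< 8 (cycle-witness-< d)

gadget : ∀ {n m} → Vec Bool m → Vec Bool m → Graph n
gadget x y = linkGraph (twist x y) (twist-suc≢ x y)

gadget-neighbours : ∀ {n m} (x y x′ y′ : Vec Bool m) v →
                    twist x y (toℕ v) ≡ twist x′ y′ (toℕ v) ×
                    twist x y (suc (toℕ v)) ≡ twist x′ y′ (suc (toℕ v)) →
                    neighbours (gadget {n} x y) v ≡ neighbours (gadget x′ y′) v
gadget-neighbours x y x′ y′ v (agree , agree-suc) =
  neighbours-cong (gadget x y) (gadget x′ y′) v
    (link-local (twist x y) (twist x′ y′) (twist-involutive x y) (twist-involutive x′ y′)
                agree agree-suc ∘ toℕ)

module _ {n m : ℕ} where

  gadget-maxDegree≤2 : (x y : Vec Bool m) → MaxDegree≤2 (gadget {n} x y)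
  gadget-maxDegree≤2 x y = linkGraph-maxDegree≤2 (twist x y) (twist-suc≢ x y) (twist-involutive x y)

  gadget-connected : m * 8 ≤ n → (x : Vec Bool m) → Connected (gadget {n} x x)
  gadget-connected m*8≤n x = hamiltonian-path⇒connected (straighten x) straighten-< adjacent onto
    where
    straighten-< : ∀ {t} → t < n → straighten x t < n
    straighten-< {t} t<n with straighten-bound x t
    ... | inj₁ fixed = subst (_< n) (sym fixed) t<n
    ... | inj₂ small = <-≤-trans small m*8≤n
    adjacent : ∀ {t u v} → toℕ u ≡ straighten x t → toℕ v ≡ straighten x (suc t) →
               adj (gadget {n} x x) u v ≡ true
    adjacent {t} u≡ v≡ = ⇒link (twist x x)
      (trans (cong (twist x x ∘ suc) u≡) (trans (twist-straighten x t) (sym v≡)))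
    onto : ∀ v → ∃[ t ] t < n × toℕ v ≡ straighten x t
    onto v = straighten x (toℕ v) , straighten-< (toℕ<n v) , sym (straighten-involutive x (toℕ v))

  gadget-disconnected : m * 8 ≤ n → {x y : Vec Bool m} → x ≢ y → ¬ Connected (gadget {n} x y)
  gadget-disconnected m*8≤n {x} {y} x≢y =
    invariant⇒¬connected (cycle d ∘ toℕ) invariant {u = on} {v = off}
      (trans (cong (cycle d) (toℕ-fromℕ< _)) (cycle-witness-on d))
      (trans (cong (cycle d) (toℕ-fromℕ< _)) (cycle-zero d))
    where
    d : Differ x y
    d = ≢⇒Differ x≢y
    witness<n : cycle-witness d < n
    witness<n = <-≤-trans (cycle-witness-< d) m*8≤n
    on off : Fin n
    on  = fromℕ< witness<n
    off = fromℕ< (≤-<-trans z≤n witness<n)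
    invariant : ∀ {u v} → adj (gadget x y) u v ≡ true → cycle d (toℕ u) ≡ cycle d (toℕ v)
    invariant {u} {v} e with link⇒ (twist x y) (toℕ u) (toℕ v) e
    ... | inj₁ p = trans (sym (cycle-invariant d (toℕ u))) (cong (cycle d) p)
    ... | inj₂ q = trans (cong (cycle d) (sym q)) (cycle-invariant d (toℕ v))

itemsOf : ∀ {n} → Graph n → List (Fin n) → List (Item n)
itemsOf G = map (λ v → v , neighbours G v)

module _ {n} {G : Graph n} where

  itemsOf-valid : ∀ H {vs} → All (λ v → neighbours H v ≡ neighbours G v) vs → ValidItems G (itemsOf H vs)
  itemsOf-valid H []       = []
  itemsOf-valid H (e ∷ es) = ↭-reflexive e ∷ itemsOf-valid H es

  validItems-++ : ∀ {xs ys} → ValidItems G xs → ValidItems G ys → ValidItems G (xs ++ ys)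
  validItems-++ []        vys = vys
  validItems-++ (e ∷ vxs) vys = e ∷ validItems-++ vxs vys

vertices-itemsOf : ∀ {n} (H : Graph n) vs → map proj₁ (itemsOf H vs) ≡ vs
vertices-itemsOf H vs = trans (sym (map-∘ vs)) (map-id vs)

module _ {n : ℕ} where

  onXSide? : Decidable₁ (T ∘ xSide ∘ toℕ {n})
  onXSide? = T? ∘ xSide ∘ toℕ

  xVertices yVertices : List (Fin n)
  xVertices = filter onXSide? (allFin n)
  yVertices = filter (∁? onXSide?) (allFin n)

  xyVertices-↭ : xVertices ++ yVertices ↭ allFin n
  xyVertices-↭ = ↭-sym (subst (λ p → allFin n ↭ proj₁ p ++ proj₂ p) (partition-defn onXSide? (allFin n))
                                (↭ₛ⇒↭ (partition-↭ (setoid (Fin n)) onXSide? (allFin n))))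

module _ {n m : ℕ} where

  xHalf yHalf : Vec Bool m → List (Item n)
  xHalf x = itemsOf (gadget x x) xVertices
  yHalf y = itemsOf (gadget y y) yVertices

  gadget-stream-valid : (x y : Vec Bool m) → ValidStream (gadget {n} x y) (xHalf x ++ yHalf y)
  gadget-stream-valid x y =
    validItems-++ (itemsOf-valid (gadget x x) (All.map xLocal (all-filter onXSide? (allFin n))))
                  (itemsOf-valid (gadget y y) (All.map yLocal (all-filter (∁? onXSide?) (allFin n)))) ,
    subst (_↭ allFin n) (sym vertices) xyVertices-↭
    where
    xLocal : ∀ {v} → T (xSide (toℕ v)) → neighbours (gadget x x) v ≡ neighbours (gadget x y) v
    xLocal {v} s = gadget-neighbours x x x y v (twist-xSide x x y (toℕ v) (Equivalence.to T-≡ s))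
    yLocal : ∀ {v} → ¬ T (xSide (toℕ v)) → neighbours (gadget y y) v ≡ neighbours (gadget x y) v
    yLocal {v} s = gadget-neighbours y y x y v (twist-ySide y x y (toℕ v) (¬-not (s ∘ Equivalence.from T-≡)))
    vertices : map proj₁ (xHalf x ++ yHalf y) ≡ xVertices ++ yVertices
    vertices = trans (map-++ proj₁ (xHalf x) (yHalf y))
                     (cong₂ _++_ (vertices-itemsOf (gadget x x) xVertices)
                                 (vertices-itemsOf (gadget y y) yVertices))

bits : ∀ {m} → Fin (2 ^ m) → Vec Bool m
bits {zero}  _ = []
bits {suc m} i = Inverse.to 2↔Bool (quotient (2 ^ m) i) ∷ bits (remainder {2} (2 ^ m) i)

bits-injective : ∀ {m} {i j : Fin (2 ^ m)} → bits {m} i ≡ bits j → i ≡ j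
bits-injective {zero} {zero} {zero} _ = refl
bits-injective {suc m} {i} {j} e = begin
  i                                                       ≡⟨ combine-remQuot (2 ^ m) i ⟨
  combine (quotient (2 ^ m) i) (remainder {2} (2 ^ m) i)  ≡⟨ cong₂ combine bit rest ⟩
  combine (quotient (2 ^ m) j) (remainder {2} (2 ^ m) j)  ≡⟨ combine-remQuot (2 ^ m) j ⟩
  j                                                       ∎
  where
  open ≡-Reasoning
  open Inverse 2↔Bool using (to; from; strictlyInverseʳ)
  bit : quotient (2 ^ m) i ≡ quotient (2 ^ m) j
  bit = trans (sym (strictlyInverseʳ _)) (trans (cong from (∷-injectiveˡ e)) (strictlyInverseʳ _))
  rest : remainder {2} (2 ^ m) i ≡ remainder (2 ^ m) j
  rest = bits-injective {m} (∷-injectiveʳ e)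

vec-pigeonhole : ∀ {m k} → k < 2 ^ m → (f : Vec Bool m → Fin k) → ∃₂ λ x y → x ≢ y × f x ≡ f y
vec-pigeonhole {m} k<2^m f with pigeonhole k<2^m (f ∘ bits {m})
... | i , j , i<j , same = bits i , bits j , <⇒≢ i<j ∘ bits-injective {m} , same

encode : ∀ {a b L} → Vec (Fin a × Fin b) L → Fin ((a * b) ^ L)
encode []             = zero
encode ((i , j) ∷ ps) = combine (combine i j) (encode ps)

encode-injective : ∀ {a b L} {ps qs : Vec (Fin a × Fin b) L} → encode ps ≡ encode qs → ps ≡ qs
encode-injective {ps = []}           {[]}           _ = refl
encode-injective {ps = (i , j) ∷ ps} {(k , l) ∷ qs} e
  with head≡ , tail≡ ← combine-injective _ _ _ _ e
  with i≡k , j≡l ← combine-injective i j k l head≡ =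
  cong₂ _∷_ (cong₂ _,_ i≡k j≡l) (encode-injective tail≡)

module _ {n p s} (A : StreamAlg n p s) where

  State : Set
  State = Fin (2 ^ s)

  runPasses : List (Fin p) → State → List (Item n) → State
  runPasses passes st str = foldl (λ m i → runPass A i m str) st passes

  runPass-++ : ∀ i st u v → runPass A i st (u ++ v) ≡ runPass A i (runPass A i st u) v
  runPass-++ i = foldl-++ (StreamAlg.trans A i)

  transcript : (passes : List (Fin p)) → State → List (Item n) → List (Item n) →
               Vec (State × State) (length passes)
  transcript []       st u v = []
  transcript (i ∷ is) st u v = (middle , end) ∷ transcript is end u v
    where
    middle end : State
    middle = runPass A i st u
    end    = runPass A i middle v

  runPasses-cut : ∀ {u₁ v₁ u₂ v₂} passes st →
                  transcript passes st u₁ v₁ ≡ transcript passes st u₂ v₂ →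
                  runPasses passes st (u₁ ++ v₂) ≡ runPasses passes st (u₁ ++ v₁)
  runPasses-cut                 []       st _ = refl
  runPasses-cut {u₁} {v₁} {u₂} {v₂} (i ∷ is) st same
    with middle≡ , end≡ ← ,-injective (∷-injectiveˡ same) = begin
    runPasses is (runPass A i st (u₁ ++ v₂)) (u₁ ++ v₂) ≡⟨ cong (λ e → runPasses is e (u₁ ++ v₂)) pass ⟩
    runPasses is end₁ (u₁ ++ v₂)                        ≡⟨ runPasses-cut is end₁ rest ⟩
    runPasses is end₁ (u₁ ++ v₁)
      ≡⟨ cong (λ e → runPasses is e (u₁ ++ v₁)) (runPass-++ i st u₁ v₁) ⟨
    runPasses is (runPass A i st (u₁ ++ v₁)) (u₁ ++ v₁) ∎
    where
    open ≡-Reasoning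
    end₁ : State
    end₁ = runPass A i (runPass A i st u₁) v₁
    pass : runPass A i st (u₁ ++ v₂) ≡ end₁
    pass = trans (runPass-++ i st u₁ v₂) (trans (cong (λ m → runPass A i m v₂) middle≡) (sym end≡))
    rest : transcript is end₁ u₁ v₁ ≡ transcript is end₁ u₂ v₂
    rest = trans (∷-injectiveʳ same) (cong (λ e → transcript is e u₂ v₂) (sym end≡))

  fooling-set-bound : ∀ {m} (u v : Vec Bool m → List (Item n)) →
                      (∀ x → run A (u x ++ v x) ≡ true) →
                      (∀ {x y} → x ≢ y → run A (u x ++ v y) ≡ false) →
                      m ≤ (s + s) * p
  fooling-set-bound {m} u v accept reject = ≮⇒≥ λ few →
    let x , y , x≢y , same =
          vec-pigeonhole (subst (_< 2 ^ m) (sym size) (^-monoʳ-< 2 (s≤s (s≤s z≤n)) few)) code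
    in true≢false (begin
      true                  ≡⟨ accept x ⟨
      run A (u x ++ v x)    ≡⟨ cong (out A) (runPasses-cut (allFin p) (init A) (encode-injective same)) ⟨
      run A (u x ++ v y)    ≡⟨ reject x≢y ⟩
      false                 ∎)
    where
    open ≡-Reasoning
    code : Vec Bool m → Fin ((2 ^ s * 2 ^ s) ^ length (allFin p))
    code x = encode (transcript (allFin p) (init A) (u x) (v x))
    size : (2 ^ s * 2 ^ s) ^ length (allFin p) ≡ 2 ^ ((s + s) * p)
    size = begin
      (2 ^ s * 2 ^ s) ^ length (allFin p) ≡⟨ cong ((2 ^ s * 2 ^ s) ^_) (length-tabulate {n = p} id) ⟩
      (2 ^ s * 2 ^ s) ^ p                 ≡⟨ cong (_^ p) (^-distribˡ-+-* 2 s s) ⟨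
      (2 ^ (s + s)) ^ p                   ≡⟨ ^-*-assoc 2 (s + s) p ⟩
      2 ^ ((s + s) * p)                   ∎

gadget-lower-bound : ∀ {n p s m} → m * 8 ≤ n → (A : StreamAlg n p s) → SolvesConnMaxDeg2 A →
                     m ≤ (s + s) * p
gadget-lower-bound {n} {m = m} m*8≤n A solves = fooling-set-bound A (xHalf {n} {m}) yHalf accept reject
  where
  answer : (x y : Vec Bool m) → let str = xHalf x ++ yHalf y in
           (run A str ≡ true → Connected (gadget {n} x y)) × (Connected (gadget {n} x y) → run A str ≡ true)
  answer x y = solves (gadget x y) (gadget-maxDegree≤2 x y) (xHalf x ++ yHalf y) (gadget-stream-valid x y)
  accept : ∀ x → run A (xHalf x ++ yHalf x) ≡ true
  accept x = proj₂ (answer x x) (gadget-connected m*8≤n x)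
  reject : ∀ {x y} → x ≢ y → run A (xHalf x ++ yHalf y) ≡ false
  reject {x} {y} x≢y = ¬-not (gadget-disconnected m*8≤n x≢y ∘ proj₁ (answer x y))

1≤2b⇒1≤b : ∀ b → 1 ≤ 2 * b → 1 ≤ b
1≤2b⇒1≤b (suc _) _ = s≤s z≤n

n≤24ps : ∀ n p s → 8 ≤ n → n / 8 ≤ (s + s) * p → n ≤ 24 * (p * s)
n≤24ps n p s 8≤n n/8≤ = begin
  n                             ≡⟨ m≡m%n+[m/n]*n n 8 ⟩
  n % 8 + n / 8 * 8             ≤⟨ +-mono-≤ n%8≤8ps (*-monoˡ-≤ 8 n/8≤2ps) ⟩
  8 * (p * s) + 2 * (p * s) * 8
    ≡⟨ solve 1 (λ b → con 8 :* b :+ con 2 :* b :* con 8 := con 24 :* b) refl (p * s) ⟩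
  24 * (p * s)                  ∎
  where
  open ≤-Reasoning
  n/8≤2ps : n / 8 ≤ 2 * (p * s)
  n/8≤2ps = ≤-trans n/8≤ (≤-reflexive (solve 2 (λ p s → (s :+ s) :* p := con 2 :* (p :* s)) refl p s))
  1≤ps : 1 ≤ p * s
  1≤ps = 1≤2b⇒1≤b (p * s) (≤-trans (m≥n⇒m/n>0 8≤n) n/8≤2ps)
  n%8≤8ps : n % 8 ≤ 8 * (p * s)
  n%8≤8ps = ≤-trans (<⇒≤ (m%n<n n 8)) (*-monoʳ-≤ 8 1≤ps)

theorem36 : ∃[ k ] ∃[ N ] (1 ≤ k × (∀ (n p s : ℕ) → N ≤ n → 1 ≤ p →
    (A : StreamAlg n p s) → SolvesConnMaxDeg2 A → n ≤ k * (p * s)))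
theorem36 = 24 , 8 , s≤s z≤n , λ n p s 8≤n _ A solves →
  n≤24ps n p s 8≤n (gadget-lower-bound (m/n*n≤m n 8) A solves)
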